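{- For all positive integers $x$ and $n$, \[ x^n \;=\; x+\sum_{s=1}^{m}\frac{2\cdot n!}{(2s)!\,(n-2s)!}\sum_{k=1}^{x-1}\sum_{j=1}^{k} j^{\,n-2s}, \] where $m=\frac{n}{2}$ if $n$ is even and $m=\frac{n-1}{2}$ if $n$ is odd.
   Context: An empty sum (upper index smaller than lower index) equals $0$. -}

module Defs where

open import Data.Nat using (ℕ; zero; suc; _+_; _*_; _∸_; _^_; _/_)
open import Data.Nat.Properties using (_!*_!≢0)
open import Data.Nat.Combinatorics using ()
open import Data.Nat.Base using (_!)

-- Σ[a ≤ i ≤ b] f i : sum of f i for i = a, …, b; empty (= 0) when b < a.
-- sum of f (a + i) for i = 0 .. len-1
sumFrom : ℕ → ℕ → (ℕ → ℕ) → ℕ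
sumFrom a zero      f = 0
sumFrom a (suc len) f = f a + sumFrom (suc a) len f

sumFromTo : ℕ → ℕ → (ℕ → ℕ) → ℕ
sumFromTo a b f = sumFrom a (suc b ∸ a) f

-- the coefficient 2 · n! / ((2s)! (n - 2s)!)   (exact division in ℕ when 2s ≤ n)
coeff : ℕ → ℕ → ℕ
coeff n s = (2 * (n !)) / ((2 * s) ! * (n ∸ 2 * s) !)
  where instance _ = (2 * s) !* (n ∸ 2 * s) !≢0

half : ℕ → ℕ
half n = n / 2

rhs : ℕ → ℕ → ℕ
rhs x n = x + sumFromTo 1 (half n) (λ s →
            coeff n s * sumFromTo 1 (x ∸ 1) (λ k → sumFromTo 1 k (λ j → j ^ (n ∸ 2 * s))))

open import Relation.Binary.PropositionalEquality using (_≡_; refl)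
_ : rhs 3 4 ≡ 81
_ = refl
_ : rhs 4 5 ≡ 1024
_ = refl
_ : sumFromTo 1 0 (λ j → j + 1) ≡ 0
_ = refl

-- Let E and O be the sums of the even- and odd-indexed terms C(n,k)·j^(n−k) of the binomial
-- expansion, so that (j+1)^n = E + O and (j−1)^n = E − O.  Adding the two, the second
-- difference (j+1)^n − 2·j^n + (j−1)^n = 2·E − 2·j^n is exactly Σ_{s≥1} coeff n s · j^(n−2s).
-- Summing a second difference of f twice telescopes:
-- Σ_{k=1}^{x−1} Σ_{j=1}^{k} Δ²f(j) = f x − x·f 1 + (x−1)·f 0, which is x^n − x for f j = j^n
-- and n ≥ 1; exchanging the order of summation gives the formula.  Working in ℕ, the identity
-- for (j−1)^n is carried as (j−1)^n + O = E, and both expansion identities follow by induction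
-- on n from the Pascal recurrences E(n+1) = j·E(n) + O(n), O(n+1) = E(n) + j·O(n).

{-# OPTIONS --safe #-}
module Submission where

open import Defs
open import Data.Nat using (ℕ; _^_; _≥_)
open import Relation.Binary.PropositionalEquality using (_≡_)

open import Data.Nat.Base using (zero; suc; _+_; _*_; _∸_; _/_; _≤_; _<_; z≤n; s≤s)
open import Data.Nat.Properties
open import Data.Nat.DivMod using (m/n≤m; m/n*n≤m; m*n/n≡m; /-monoˡ-≤; *-/-assoc)
open import Data.Nat.Combinatorics
  using (_C_; k>n⇒nCk≡0; nCk+nC[k+1]≡[n+1]C[k+1]; nCk≡n!/k![n-k]!; k![n∸k]!∣n!)
open import Data.Nat.Tactic.RingSolver using (solve-∀)
open import Relation.Binary.PropositionalEquality
  using (refl; sym; trans; cong; cong₂; subst; module ≡-Reasoning)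
open import Relation.Nullary using (yes; no)

open ≡-Reasoning

sumFrom-cong< : ∀ a L {f g : ℕ → ℕ} → (∀ i → i < a + L → f i ≡ g i) →
                sumFrom a L f ≡ sumFrom a L g
sumFrom-cong< a zero    f≗g = refl
sumFrom-cong< a (suc L) f≗g =
  cong₂ _+_ (f≗g a (m<m+n a (s≤s z≤n)))
            (sumFrom-cong< (suc a) L (λ i i< → f≗g i (subst (i <_) (sym (+-suc a L)) i<)))

sumFrom-cong : ∀ a L {f g : ℕ → ℕ} → (∀ i → f i ≡ g i) → sumFrom a L f ≡ sumFrom a L g
sumFrom-cong a L f≗g = sumFrom-cong< a L (λ i _ → f≗g i)

sumFrom-vanish : ∀ a L {f : ℕ → ℕ} → (∀ i → a ≤ i → f i ≡ 0) → sumFrom a L f ≡ 0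
sumFrom-vanish a zero    f≡0 = refl
sumFrom-vanish a (suc L) f≡0 =
  cong₂ _+_ (f≡0 a ≤-refl) (sumFrom-vanish (suc a) L (λ i a<i → f≡0 i (<⇒≤ a<i)))

sumFrom-truncate : ∀ a {M L} {f : ℕ → ℕ} → M ≤ L → (∀ i → a + M ≤ i → f i ≡ 0) →
                   sumFrom a L f ≡ sumFrom a M f
sumFrom-truncate a {zero}  {L} _ f≡0 =
  sumFrom-vanish a L (λ i a≤i → f≡0 i (subst (_≤ i) (sym (+-identityʳ a)) a≤i))
sumFrom-truncate a {suc M} {f = f} (s≤s M≤L) f≡0 =
  cong (f a +_) (sumFrom-truncate (suc a) M≤L
                  (λ i a+M<i → f≡0 i (subst (_≤ i) (sym (+-suc a M)) a+M<i)))

sumFrom-distrib-+ : ∀ a L (f g : ℕ → ℕ) →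
                    sumFrom a L (λ i → f i + g i) ≡ sumFrom a L f + sumFrom a L g
sumFrom-distrib-+ a zero    f g = refl
sumFrom-distrib-+ a (suc L) f g = begin
  f a + g a + sumFrom (suc a) L (λ i → f i + g i)
    ≡⟨ cong (f a + g a +_) (sumFrom-distrib-+ (suc a) L f g) ⟩
  f a + g a + (sumFrom (suc a) L f + sumFrom (suc a) L g)
    ≡⟨ +-+-exchange (f a) (g a) _ _ ⟩
  f a + sumFrom (suc a) L f + (g a + sumFrom (suc a) L g)
    ∎
  where
  +-+-exchange : ∀ w x y z → w + x + (y + z) ≡ w + y + (x + z)
  +-+-exchange = solve-∀

*-distribˡ-sumFrom : ∀ c a L (f : ℕ → ℕ) → c * sumFrom a L f ≡ sumFrom a L (λ i → c * f i)
*-distribˡ-sumFrom c a zero    f = *-zeroʳ c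
*-distribˡ-sumFrom c a (suc L) f =
  trans (*-distribˡ-+ c (f a) _) (cong (c * f a +_) (*-distribˡ-sumFrom c (suc a) L f))

sumFrom-suc : ∀ a L (f : ℕ → ℕ) → sumFrom (suc a) L f ≡ sumFrom a L (λ i → f (suc i))
sumFrom-suc a zero    f = refl
sumFrom-suc a (suc L) f = cong (f (suc a) +_) (sumFrom-suc (suc a) L f)

sumFrom-init-last : ∀ a L (f : ℕ → ℕ) → sumFrom a (suc L) f ≡ sumFrom a L f + f (a + L)
sumFrom-init-last a zero    f = trans (+-comm (f a) 0) (cong f (sym (+-identityʳ a)))
sumFrom-init-last a (suc L) f = begin
  f a + sumFrom (suc a) (suc L) f
    ≡⟨ cong (f a +_) (sumFrom-init-last (suc a) L f) ⟩
  f a + (sumFrom (suc a) L f + f (suc a + L))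
    ≡⟨ +-assoc (f a) _ _ ⟨
  f a + sumFrom (suc a) L f + f (suc (a + L))
    ≡⟨ cong (λ i → f a + sumFrom (suc a) L f + f i) (+-suc a L) ⟨
  f a + sumFrom (suc a) L f + f (a + suc L)
    ∎

sumFrom-extend : ∀ a L {f : ℕ → ℕ} → f (a + L) ≡ 0 → sumFrom a (suc L) f ≡ sumFrom a L f
sumFrom-extend a L {f} f[a+L]≡0 = begin
  sumFrom a (suc L) f         ≡⟨ sumFrom-init-last a L f ⟩
  sumFrom a L f + f (a + L)   ≡⟨ cong (sumFrom a L f +_) f[a+L]≡0 ⟩
  sumFrom a L f + 0           ≡⟨ +-identityʳ _ ⟩
  sumFrom a L f               ∎

sumFrom-comm : ∀ a L b K (f : ℕ → ℕ → ℕ) →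
               sumFrom a L (λ s → sumFrom b K (f s)) ≡
               sumFrom b K (λ k → sumFrom a L (λ s → f s k))
sumFrom-comm a zero    b K f = sym (sumFrom-vanish b K (λ _ _ → refl))
sumFrom-comm a (suc L) b K f = begin
  sumFrom b K (f a) + sumFrom (suc a) L (λ s → sumFrom b K (f s))
    ≡⟨ cong (sumFrom b K (f a) +_) (sumFrom-comm (suc a) L b K f) ⟩
  sumFrom b K (f a) + sumFrom b K (λ k → sumFrom (suc a) L (λ s → f s k))
    ≡⟨ sumFrom-distrib-+ b K (f a) _ ⟨
  sumFrom b K (λ k → f a k + sumFrom (suc a) L (λ s → f s k))
    ∎

n<2*[1+n] : ∀ n → n < 2 * suc n
n<2*[1+n] n = m≤m+n (suc n) (suc n + 0)

module _ (j : ℕ) where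

  binomialTerm : ℕ → ℕ → ℕ
  binomialTerm n k = (n C k) * j ^ (n ∸ k)

  binomialTerm-vanish : ∀ {n k} → n < k → binomialTerm n k ≡ 0
  binomialTerm-vanish {n} {k} n<k = cong (_* j ^ (n ∸ k)) (k>n⇒nCk≡0 n<k)

  binomialTerm-zero : ∀ n → binomialTerm (suc n) 0 ≡ j * binomialTerm n 0
  binomialTerm-zero n = trans (*-identityˡ (j ^ suc n)) (cong (j *_) (sym (*-identityˡ (j ^ n))))

  binomialTerm-pascal : ∀ n k →
    binomialTerm (suc n) (suc k) ≡ binomialTerm n k + j * binomialTerm n (suc k)
  binomialTerm-pascal n k = begin
    (suc n C suc k) * j ^ (n ∸ k)
      ≡⟨ cong (_* j ^ (n ∸ k)) (nCk+nC[k+1]≡[n+1]C[k+1] n k) ⟨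
    (n C k + n C suc k) * j ^ (n ∸ k)
      ≡⟨ *-distribʳ-+ (j ^ (n ∸ k)) (n C k) _ ⟩
    binomialTerm n k + (n C suc k) * j ^ (n ∸ k)
      ≡⟨ cong (binomialTerm n k +_) C*^-pull ⟩
    binomialTerm n k + j * binomialTerm n (suc k)
      ∎
    where
    C*^-pull : (n C suc k) * j ^ (n ∸ k) ≡ j * binomialTerm n (suc k)
    C*^-pull with k <? n
    ... | yes k<n = begin
      (n C suc k) * j ^ (suc n ∸ suc k)
        ≡⟨ cong (λ e → (n C suc k) * j ^ e) (+-∸-assoc 1 k<n) ⟩
      (n C suc k) * (j * j ^ (n ∸ suc k))
        ≡⟨ x*[y*z]≡y*[x*z] (n C suc k) j _ ⟩
      j * binomialTerm n (suc k)
        ∎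
      where
      x*[y*z]≡y*[x*z] : ∀ x y z → x * (y * z) ≡ y * (x * z)
      x*[y*z]≡y*[x*z] = solve-∀
    ... | no k≮n = begin
      (n C suc k) * j ^ (n ∸ k)  ≡⟨ cong (_* j ^ (n ∸ k)) (k>n⇒nCk≡0 n<1+k) ⟩
      0                          ≡⟨ *-zeroʳ j ⟨
      j * 0                      ≡⟨ cong (j *_) (binomialTerm-vanish n<1+k) ⟨
      j * binomialTerm n (suc k) ∎
      where
      n<1+k : n < suc k
      n<1+k = s≤s (≮⇒≥ k≮n)

  evenSum oddSum : ℕ → ℕ → ℕ
  evenSum n L = sumFrom 0 L (λ s → binomialTerm n (2 * s))
  oddSum  n L = sumFrom 0 L (λ s → binomialTerm n (suc (2 * s)))

  evenSum-suc : ∀ n L → evenSum (suc n) (suc L) ≡ j * evenSum n (suc L) + oddSum n L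
  evenSum-suc n L = begin
    binomialTerm (suc n) 0 + sumFrom 1 L (λ s → binomialTerm (suc n) (2 * s))
      ≡⟨ cong₂ _+_ (binomialTerm-zero n) (sumFrom-suc 0 L _) ⟩
    j * t₀ + sumFrom 0 L (λ s → binomialTerm (suc n) (2 * suc s))
      ≡⟨ cong (j * t₀ +_) (sumFrom-cong 0 L evenTerm-pascal) ⟩
    j * t₀ + sumFrom 0 L (λ s → binomialTerm n (suc (2 * s)) + j * binomialTerm n (2 * suc s))
      ≡⟨ cong (j * t₀ +_) (sumFrom-distrib-+ 0 L _ _) ⟩
    j * t₀ + (oddSum n L + sumFrom 0 L (λ s → j * binomialTerm n (2 * suc s)))
      ≡⟨ cong (λ e → j * t₀ + (oddSum n L + e)) (*-distribˡ-sumFrom j 0 L _) ⟨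
    j * t₀ + (oddSum n L + j * sumFrom 0 L (λ s → binomialTerm n (2 * suc s)))
      ≡⟨ cong (λ e → j * t₀ + (oddSum n L + j * e)) (sumFrom-suc 0 L _) ⟨
    j * t₀ + (oddSum n L + j * sumFrom 1 L (λ s → binomialTerm n (2 * s)))
      ≡⟨ regroup j t₀ (oddSum n L) _ ⟩
    j * (t₀ + sumFrom 1 L (λ s → binomialTerm n (2 * s))) + oddSum n L
      ∎
    where
    t₀ : ℕ
    t₀ = binomialTerm n 0
    evenTerm-pascal : ∀ s → binomialTerm (suc n) (2 * suc s) ≡
                            binomialTerm n (suc (2 * s)) + j * binomialTerm n (2 * suc s)
    evenTerm-pascal s =
      subst (λ m → binomialTerm (suc n) m ≡ binomialTerm n (suc (2 * s)) + j * binomialTerm n m)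
            (sym (*-suc 2 s)) (binomialTerm-pascal n (suc (2 * s)))
    regroup : ∀ j t o e → j * t + (o + j * e) ≡ j * (t + e) + o
    regroup = solve-∀

  oddSum-suc : ∀ n L → oddSum (suc n) L ≡ evenSum n L + j * oddSum n L
  oddSum-suc n L = begin
    sumFrom 0 L (λ s → binomialTerm (suc n) (suc (2 * s)))
      ≡⟨ sumFrom-cong 0 L (λ s → binomialTerm-pascal n (2 * s)) ⟩
    sumFrom 0 L (λ s → binomialTerm n (2 * s) + j * binomialTerm n (suc (2 * s)))
      ≡⟨ sumFrom-distrib-+ 0 L _ _ ⟩
    evenSum n L + sumFrom 0 L (λ s → j * binomialTerm n (suc (2 * s)))
      ≡⟨ cong (evenSum n L +_) (*-distribˡ-sumFrom j 0 L _) ⟨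
    evenSum n L + j * oddSum n L
      ∎

  evenSum-extend : ∀ n L → n < 2 * L → evenSum n (suc L) ≡ evenSum n L
  evenSum-extend n L n<2L = sumFrom-extend 0 L (binomialTerm-vanish n<2L)

  oddSum-extend : ∀ n L → n < 2 * L → oddSum n (suc L) ≡ oddSum n L
  oddSum-extend n L n<2L = sumFrom-extend 0 L (binomialTerm-vanish (m<n⇒m<1+n n<2L))

  -- Any length L with n < 2 * L gives the same sums; suc n is one that works uniformly in n.
  evenPart oddPart : ℕ → ℕ
  evenPart n = evenSum n (suc n)
  oddPart  n = oddSum  n (suc n)

  evenPart-suc : ∀ n → evenPart (suc n) ≡ j * evenPart n + oddPart n
  evenPart-suc n = trans (evenSum-suc n (suc n))
    (cong (λ e → j * e + oddPart n) (evenSum-extend n (suc n) (n<2*[1+n] n)))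

  oddPart-suc : ∀ n → oddPart (suc n) ≡ evenPart n + j * oddPart n
  oddPart-suc n = trans (oddSum-suc n (suc (suc n)))
    (cong₂ (λ e o → e + j * o) (evenSum-extend n (suc n) (n<2*[1+n] n))
                               (oddSum-extend n (suc n) (n<2*[1+n] n)))

  [1+j]^n≡evenPart+oddPart : ∀ n → suc j ^ n ≡ evenPart n + oddPart n
  [1+j]^n≡evenPart+oddPart zero    = refl
  [1+j]^n≡evenPart+oddPart (suc n) = begin
    suc j * suc j ^ n                  ≡⟨ cong (suc j *_) ([1+j]^n≡evenPart+oddPart n) ⟩
    suc j * (e + o)                    ≡⟨ split j e o ⟩
    (j * e + o) + (e + j * o)          ≡⟨ cong₂ _+_ (evenPart-suc n) (oddPart-suc n) ⟨
    evenPart (suc n) + oddPart (suc n) ∎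
    where
    e o : ℕ
    e = evenPart n
    o = oddPart n
    split : ∀ j e o → suc j * (e + o) ≡ (j * e + o) + (e + j * o)
    split = solve-∀

^+oddPart≡evenPart : ∀ a n → a ^ n + oddPart (suc a) n ≡ evenPart (suc a) n
^+oddPart≡evenPart a zero    = refl
^+oddPart≡evenPart a (suc n) = begin
  a * a ^ n + oddPart (suc a) (suc n)
    ≡⟨ cong (a * a ^ n +_) (oddPart-suc (suc a) n) ⟩
  a * a ^ n + (e + suc a * o)
    ≡⟨ cong (λ e′ → a * a ^ n + (e′ + suc a * o)) (^+oddPart≡evenPart a n) ⟨
  a * a ^ n + ((a ^ n + o) + suc a * o)
    ≡⟨ regroup a (a ^ n) o ⟩
  suc a * (a ^ n + o) + o
    ≡⟨ cong (λ e′ → suc a * e′ + o) (^+oddPart≡evenPart a n) ⟩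
  suc a * e + o
    ≡⟨ evenPart-suc (suc a) n ⟨
  evenPart (suc a) (suc n)
    ∎
  where
  e o : ℕ
  e = evenPart (suc a) n
  o = oddPart (suc a) n
  regroup : ∀ a p o → a * p + ((p + o) + suc a * o) ≡ suc a * (p + o) + o
  regroup = solve-∀

s≤n/2⇒2*s≤n : ∀ {s n} → s ≤ n / 2 → 2 * s ≤ n
s≤n/2⇒2*s≤n {s} {n} s≤n/2 =
  ≤-trans (*-monoʳ-≤ 2 s≤n/2) (subst (_≤ n) (*-comm (n / 2) 2) (m/n*n≤m n 2))

n/2<s⇒n<2*s : ∀ {s n} → n / 2 < s → n < 2 * s
n/2<s⇒n<2*s {s} {n} n/2<s = ≰⇒> λ 2s≤n →
  <⇒≱ n/2<s (subst (_≤ n / 2) (m*n/n≡m s 2) (/-monoˡ-≤ 2 (subst (_≤ n) (*-comm 2 s) 2s≤n)))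

coeff≡2*nC2s : ∀ n s → 2 * s ≤ n → coeff n s ≡ 2 * (n C (2 * s))
coeff≡2*nC2s n s 2s≤n =
  trans (*-/-assoc 2 ⦃ _ ⦄ (k![n∸k]!∣n! 2s≤n)) (cong (2 *_) (sym (nCk≡n!/k![n-k]! 2s≤n)))

secondDifference : ℕ → ℕ → ℕ
secondDifference n j = sumFrom 1 (n / 2) (λ s → coeff n s * j ^ (n ∸ 2 * s))

2*evenPart≡2*^+secondDifference : ∀ j n → 2 * evenPart j n ≡ 2 * j ^ n + secondDifference n j
2*evenPart≡2*^+secondDifference j n = begin
  2 * (1 * j ^ n + sumFrom 1 n term)
    ≡⟨ distrib (j ^ n) _ ⟩
  2 * j ^ n + 2 * sumFrom 1 n term
    ≡⟨ cong (λ t → 2 * j ^ n + 2 * t) (sumFrom-truncate 1 (m/n≤m n 2) vanish) ⟩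
  2 * j ^ n + 2 * sumFrom 1 (n / 2) term
    ≡⟨ cong (2 * j ^ n +_) (*-distribˡ-sumFrom 2 1 (n / 2) term) ⟩
  2 * j ^ n + sumFrom 1 (n / 2) (λ s → 2 * term s)
    ≡⟨ cong (2 * j ^ n +_) (sumFrom-cong< 1 (n / 2) twice-term) ⟩
  2 * j ^ n + secondDifference n j
    ∎
  where
  term : ℕ → ℕ
  term s = binomialTerm j n (2 * s)
  distrib : ∀ p t → 2 * (1 * p + t) ≡ 2 * p + 2 * t
  distrib = solve-∀
  vanish : ∀ s → 1 + n / 2 ≤ s → term s ≡ 0
  vanish s n/2<s = binomialTerm-vanish j (n/2<s⇒n<2*s n/2<s)
  twice-term : ∀ s → s < 1 + n / 2 → 2 * term s ≡ coeff n s * j ^ (n ∸ 2 * s)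
  twice-term s (s≤s s≤n/2) = begin
    2 * ((n C (2 * s)) * j ^ (n ∸ 2 * s))
      ≡⟨ *-assoc 2 (n C (2 * s)) _ ⟨
    2 * (n C (2 * s)) * j ^ (n ∸ 2 * s)
      ≡⟨ cong (_* j ^ (n ∸ 2 * s)) (coeff≡2*nC2s n s (s≤n/2⇒2*s≤n s≤n/2)) ⟨
    coeff n s * j ^ (n ∸ 2 * s)
      ∎

^-secondDifference : ∀ n a → (2 + a) ^ n + a ^ n ≡ 2 * (1 + a) ^ n + secondDifference n (1 + a)
^-secondDifference n a = +-cancelʳ-≡ o _ _ (begin
  (2 + a) ^ n + a ^ n + o
    ≡⟨ +-assoc ((2 + a) ^ n) (a ^ n) o ⟩
  (2 + a) ^ n + (a ^ n + o)
    ≡⟨ cong₂ _+_ ([1+j]^n≡evenPart+oddPart (1 + a) n) (^+oddPart≡evenPart a n) ⟩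
  (e + o) + e
    ≡⟨ regroup e o ⟩
  2 * e + o
    ≡⟨ cong (_+ o) (2*evenPart≡2*^+secondDifference (1 + a) n) ⟩
  2 * (1 + a) ^ n + secondDifference n (1 + a) + o
    ∎)
  where
  e o : ℕ
  e = evenPart (1 + a) n
  o = oddPart (1 + a) n
  regroup : ∀ e o → (e + o) + e ≡ 2 * e + o
  regroup = solve-∀

-- Discrete Taylor formula of order two, with every term moved so that no subtraction occurs.
module _ {f g : ℕ → ℕ} (Δ²f≡g : ∀ k → f (2 + k) + f k ≡ 2 * f (1 + k) + g (1 + k)) where

  sum-of-second-differences : ∀ K → sumFrom 1 K g + f K + f 1 ≡ f (1 + K) + f 0
  sum-of-second-differences zero    = +-comm (f 0) (f 1)
  sum-of-second-differences (suc K) = +-cancelʳ-≡ (f K) _ _ (begin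
    sumFrom 1 (suc K) g + f (1 + K) + f 1 + f K
      ≡⟨ cong (λ S → S + f (1 + K) + f 1 + f K) (sumFrom-init-last 1 K g) ⟩
    sumFrom 1 K g + g (1 + K) + f (1 + K) + f 1 + f K
      ≡⟨ regroup₁ (sumFrom 1 K g) (g (1 + K)) (f (1 + K)) (f 1) (f K) ⟩
    (sumFrom 1 K g + f K + f 1) + g (1 + K) + f (1 + K)
      ≡⟨ cong (λ S → S + g (1 + K) + f (1 + K)) (sum-of-second-differences K) ⟩
    (f (1 + K) + f 0) + g (1 + K) + f (1 + K)
      ≡⟨ regroup₂ (f (1 + K)) (f 0) (g (1 + K)) ⟩
    (2 * f (1 + K) + g (1 + K)) + f 0
      ≡⟨ cong (_+ f 0) (Δ²f≡g K) ⟨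
    f (2 + K) + f K + f 0
      ≡⟨ regroup₃ (f (2 + K)) (f K) (f 0) ⟩
    f (2 + K) + f 0 + f K
      ∎)
    where
    regroup₁ : ∀ S y x u v → S + y + x + u + v ≡ (S + v + u) + y + x
    regroup₁ = solve-∀
    regroup₂ : ∀ x z y → (x + z) + y + x ≡ (2 * x + y) + z
    regroup₂ = solve-∀
    regroup₃ : ∀ x y z → x + y + z ≡ x + z + y
    regroup₃ = solve-∀

  double-sum-of-second-differences : ∀ K →
    sumFrom 1 K (λ k → sumFrom 1 k g) + (1 + K) * f 1 + f 0 ≡ f (1 + K) + (1 + K) * f 0
  double-sum-of-second-differences zero    = regroup (f 1) (f 0)
    where
    regroup : ∀ x z → 1 * x + z ≡ x + 1 * z
    regroup = solve-∀
  double-sum-of-second-differences (suc K) = begin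
    sumFrom 1 (suc K) G + (2 + K) * f 1 + f 0
      ≡⟨ cong (λ S → S + (2 + K) * f 1 + f 0) (sumFrom-init-last 1 K G) ⟩
    sumFrom 1 K G + G (1 + K) + (2 + K) * f 1 + f 0
      ≡⟨ regroup₁ (sumFrom 1 K G) (G (1 + K)) K (f 1) (f 0) ⟩
    (sumFrom 1 K G + (1 + K) * f 1 + f 0) + (G (1 + K) + f 1)
      ≡⟨ cong (_+ (G (1 + K) + f 1)) (double-sum-of-second-differences K) ⟩
    (f (1 + K) + (1 + K) * f 0) + (G (1 + K) + f 1)
      ≡⟨ regroup₂ (f (1 + K)) K (f 0) (G (1 + K)) (f 1) ⟩
    (G (1 + K) + f (1 + K) + f 1) + (1 + K) * f 0
      ≡⟨ cong (_+ (1 + K) * f 0) (sum-of-second-differences (1 + K)) ⟩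
    (f (2 + K) + f 0) + (1 + K) * f 0
      ≡⟨ regroup₃ (f (2 + K)) (f 0) K ⟩
    f (2 + K) + (2 + K) * f 0
      ∎
    where
    G : ℕ → ℕ
    G k = sumFrom 1 k g
    regroup₁ : ∀ S y K u z → S + y + (2 + K) * u + z ≡ (S + (1 + K) * u + z) + (y + u)
    regroup₁ = solve-∀
    regroup₂ : ∀ x K z y u → (x + (1 + K) * z) + (y + u) ≡ (y + x + u) + (1 + K) * z
    regroup₂ = solve-∀
    regroup₃ : ∀ x z K → (x + z) + (1 + K) * z ≡ x + (2 + K) * z
    regroup₃ = solve-∀

^-as-double-sum : ∀ n x →
  suc x + sumFrom 1 x (λ k → sumFrom 1 k (secondDifference (suc n))) ≡ suc x ^ suc n
^-as-double-sum n x = begin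
  suc x + D
    ≡⟨ +-comm (suc x) D ⟩
  D + suc x
    ≡⟨ cong (D +_) (*-identityʳ (suc x)) ⟨
  D + suc x * 1
    ≡⟨ +-identityʳ _ ⟨
  D + suc x * 1 + 0
    ≡⟨ cong (λ u → D + suc x * u + 0) (^-zeroˡ (suc n)) ⟨
  D + suc x * 1 ^ suc n + 0 ^ suc n
    ≡⟨ double-sum-of-second-differences {_^ suc n} (^-secondDifference (suc n)) x ⟩
  suc x ^ suc n + suc x * 0 ^ suc n
    ≡⟨ cong (suc x ^ suc n +_) (*-zeroʳ (suc x)) ⟩
  suc x ^ suc n + 0
    ≡⟨ +-identityʳ _ ⟩
  suc x ^ suc n
    ∎
  where
  D : ℕ
  D = sumFrom 1 x (λ k → sumFrom 1 k (secondDifference (suc n)))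

rhs≡+double-sum : ∀ x n →
  rhs x n ≡ x + sumFrom 1 (x ∸ 1) (λ k → sumFrom 1 k (secondDifference n))
rhs≡+double-sum x n = cong (x +_) (begin
  sumFrom 1 (n / 2) (λ s → coeff n s * sumFrom 1 X (λ k → sumFrom 1 k (λ j → j ^ (n ∸ 2 * s))))
    ≡⟨ sumFrom-cong 1 (n / 2) (λ s → trans (*-distribˡ-sumFrom (coeff n s) 1 X _)
                                      (sumFrom-cong 1 X (λ k → *-distribˡ-sumFrom (coeff n s) 1 k _))) ⟩
  sumFrom 1 (n / 2) (λ s → sumFrom 1 X (λ k → sumFrom 1 k (λ j → coeff n s * j ^ (n ∸ 2 * s))))
    ≡⟨ sumFrom-comm 1 (n / 2) 1 X _ ⟩
  sumFrom 1 X (λ k → sumFrom 1 (n / 2) (λ s → sumFrom 1 k (λ j → coeff n s * j ^ (n ∸ 2 * s))))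
    ≡⟨ sumFrom-cong 1 X (λ k → sumFrom-comm 1 (n / 2) 1 k _) ⟩
  sumFrom 1 X (λ k → sumFrom 1 k (secondDifference n))
    ∎)
  where
  X : ℕ
  X = x ∸ 1

theorem2p1 : (x n : ℕ) → x ≥ 1 → n ≥ 1 → x ^ n ≡ rhs x n
theorem2p1 (suc x) (suc n) _ _ =
  sym (trans (rhs≡+double-sum (suc x) (suc n)) (^-as-double-sum n x))
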